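{- Let $k$ be a positive integer. A graph $G$ is not b-$\chi$-$k$-bounded if and only if $G$ contains, as an induced subgraph, a minimal $\chi$-$k$-unbounded b-atom.
   Context: $\chi(H)$ denotes the chromatic number. A proper $k$-coloring is a surjective map $c:V\to\{1,\dots,k\}$ with adjacent vertices receiving different colors; in it, a vertex $v$ of color $i$ is a b-vertex if for every $j\ne i$ it has a neighbor of color $j$. A b-$k$-coloring is a proper $k$-coloring where every color class contains a b-vertex; $\varphi(H)$ is the largest $k$ such that $H$ has a b-$k$-coloring. A b-$t$-atom is a graph whose vertex set can be partitioned into $t$ sets $D_1,\dots,D_t$, each $D_i$ containing a special vertex $c_i$, such that each $D_i$ is independent with $|D_i|\le t$ and for all $i\ne j$, $c_i$ has a neighbor in $D_j$. A graph $G$ is b-$\chi$-$k$-bounded if $\varphi(G')-\chi(G')\le k$ for every induced subgraph $G'$ of $G$. A graph $H$ is a $\chi$-$k$-unbounded b-atom if $\varphi(H)-\chi(H)>k$ and $H$ is a b-$t$-atom for some integer $t$. Such a graph is minimal if no $\chi$-$k$-unbounded b-atom is a proper induced subgraph of it. -}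

module Defs where

open import Data.Nat using (ℕ; _≤_; _<_; _+_)
open import Data.Fin using (Fin; _≟_)
open import Data.Bool using (Bool; true; false)
open import Data.List using (List; length; filter; allFin)
open import Data.Product using (Σ; ∃; ∃-syntax; _×_; _,_)
open import Relation.Binary.PropositionalEquality using (_≡_; _≢_)
open import Relation.Nullary using (¬_)
open import Function.Definitions using (Injective)

record Graph : Set where
  field
    n       : ℕ
    adj     : Fin n → Fin n → Bool
    adj-sym : ∀ u v → adj u v ≡ adj v u
    adj-irr : ∀ v → adj v v ≡ false
open Graph public

Adjacent : (G : Graph) → Fin (n G) → Fin (n G) → Set
Adjacent G u v = adj G u v ≡ true

InducedSubgraph : Graph → Graph → Set
InducedSubgraph H G =
  Σ (Fin (n H) → Fin (n G)) λ f →
    Injective _≡_ _≡_ f × (∀ u v → adj H u v ≡ adj G (f u) (f v))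

ProperInducedSubgraph : Graph → Graph → Set
ProperInducedSubgraph H G = InducedSubgraph H G × n H < n G

IsProperColoring : (G : Graph) (k : ℕ) → (Fin (n G) → Fin k) → Set
IsProperColoring G k c =
  (∀ u v → Adjacent G u v → c u ≢ c v) × (∀ (j : Fin k) → ∃[ v ] c v ≡ j)

HasProperColoring : Graph → ℕ → Set
HasProperColoring G k = Σ (Fin (n G) → Fin k) (IsProperColoring G k)

IsBVertex : (G : Graph) (k : ℕ) → (Fin (n G) → Fin k) → Fin (n G) → Set
IsBVertex G k c v =
  ∀ (j : Fin k) → j ≢ c v → ∃[ w ] (Adjacent G v w × c w ≡ j)

IsBColoring : (G : Graph) (k : ℕ) → (Fin (n G) → Fin k) → Set
IsBColoring G k c =
  IsProperColoring G k c × (∀ (i : Fin k) → ∃[ v ] (c v ≡ i × IsBVertex G k c v))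

HasBColoring : Graph → ℕ → Set
HasBColoring G k = Σ (Fin (n G) → Fin k) (IsBColoring G k)

IsChromaticNumber : Graph → ℕ → Set
IsChromaticNumber G a = HasProperColoring G a × (∀ b → HasProperColoring G b → a ≤ b)

IsBChromaticNumber : Graph → ℕ → Set
IsBChromaticNumber G b = HasBColoring G b × (∀ b' → HasBColoring G b' → b' ≤ b)

BGapAtMost : ℕ → Graph → Set
BGapAtMost k H = ∀ a b → IsChromaticNumber H a → IsBChromaticNumber H b → b ≤ a + k

BGapExceeds : ℕ → Graph → Set
BGapExceeds k H = ∃[ a ] ∃[ b ] (IsChromaticNumber H a × IsBChromaticNumber H b × a + k < b)

BChiBounded : ℕ → Graph → Set
BChiBounded k G = ∀ (H : Graph) → InducedSubgraph H G → BGapAtMost k H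

-- G is a b-t-atom: partition d into D_1..D_t with special vertices c_i ∈ D_i
IsBAtom : ℕ → Graph → Set
IsBAtom t G =
  Σ (Fin (n G) → Fin t) λ d →
  Σ (Fin t → Fin (n G)) λ c →
    (∀ i → d (c i) ≡ i)
    × (∀ u v → Adjacent G u v → d u ≢ d v)
    × (∀ i → length (filter (λ v → d v ≟ i) (allFin (n G))) ≤ t)
    × (∀ i j → i ≢ j → ∃[ v ] (Adjacent G (c i) v × d v ≡ j))

IsUnboundedBAtom : ℕ → Graph → Set
IsUnboundedBAtom k H = BGapExceeds k H × ∃[ t ] IsBAtom t H

IsMinimalUnboundedBAtom : ℕ → Graph → Set
IsMinimalUnboundedBAtom k H =
  IsUnboundedBAtom k H
  × (∀ (H' : Graph) → ProperInducedSubgraph H' H → ¬ IsUnboundedBAtom k H')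

-- A graph that is not b-χ-k-bounded has an induced subgraph H with φ(H) > χ(H) + k. Fix a
-- b-colouring of H with φ(H) colours, take one b-vertex c_i per colour i and, for every other
-- colour j, a neighbour of c_i of colour j. The subgraph induced on these vertices is a
-- b-φ(H)-atom (the colour classes form the partition, each of size at most φ(H)); the restricted
-- colouring is still a b-colouring, so its b-chromatic number is at least φ(H), while its
-- chromatic number is at most χ(H). Among all χ-k-unbounded b-atoms induced in G one of least
-- order is minimal; the converse is immediate. As ¬ BChiBounded is only a negation, the witnesses
-- are found by exhaustive search over the finitely many colourings and induced subgraphs.
module Submission where

open import Defs
open import Data.Nat using (ℕ; zero; suc; _≤_; _<_; _+_; s≤s; s≤s⁻¹; _≤?_; _<?_)
open import Data.Nat.Properties
  using ( anyUpTo?; allUpTo?; ≤-refl; ≤-trans; <⇒≱; ≰⇒>; ≮⇒≥; ≤∧≢⇒<; n≤0⇒n≡0; m≤n⇒m≤1+n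
        ; <-≤-trans; ≤-<-trans; +-monoˡ-≤)
open import Data.Nat.Induction using (<-rec)
open import Data.Fin using (Fin; zero; suc; _≟_; punchOut)
open import Data.Fin.Properties using (any?; all?; injective⇒≤; punchOut-injective; ¬∀⟶∃¬)
open import Data.Vec.Functional using (head; tail) renaming (_∷_ to _◂_)
import Data.Bool as Bool
open import Data.List using (List; _∷_; length; filter; allFin; lookup)
open import Data.List.Properties using (filter-≐)
open import Data.List.Relation.Unary.Unique.Propositional using (Unique)
open import Data.List.Relation.Unary.Unique.Propositional.Properties using (allFin⁺; filter⁺)
open import Data.List.Relation.Unary.AllPairs.Core using (_∷_)
import Data.List.Relation.Unary.All as All
import Data.List.Relation.Unary.Any as Any
open import Data.List.Relation.Unary.Any.Properties using (lookup-index)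
open import Data.List.Membership.Propositional.Properties
  using (∈-filter⁺; ∈-filter⁻; ∈-lookup; ∈-allFin)
open import Data.Product using (Σ; ∃; ∃₂; ∃-syntax; _×_; _,_; proj₁; proj₂)
open import Data.Empty using (⊥-elim)
open import Relation.Binary.PropositionalEquality
  using (_≡_; _≢_; _≗_; refl; sym; trans; cong; cong₂; subst; subst₂)
open import Relation.Nullary using (¬_; Dec; yes; no)
open import Relation.Nullary.Decidable using (_×-dec_; _→-dec_; ¬?; map′)
open import Level using (0ℓ)
open import Relation.Unary using (Pred; Decidable)
open import Function using (_∘_)
open import Function.Definitions using (Injective)
open import Function.Bundles using (_⇔_; mk⇔)

Least : Pred ℕ 0ℓ → Set
Least P = ∃ λ m → P m × (∀ {m′} → m′ < m → ¬ P m′)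

least : {P : Pred ℕ 0ℓ} → Decidable P → ∀ {m} → P m → Least P
least {P} P? {m} = <-rec (λ m → P m → Least P) step m
  where
  step : ∀ m → (∀ {m′} → m′ < m → P m′ → Least P) → P m → Least P
  step m smaller pm with anyUpTo? P? m
  ... | yes (m′ , m′<m , pm′) = smaller m′<m pm′
  ... | no none = m , pm , λ m′<m pm′ → none (_ , m′<m , pm′)

greatest : {P : Pred ℕ 0ℓ} → Decidable P → ∀ N → (∀ {m} → P m → m ≤ N) → ∀ {m} → P m →
  ∃ λ m* → P m* × (∀ {m′} → P m′ → m′ ≤ m*)
greatest {P} P? zero bounded pm = 0 , subst P (n≤0⇒n≡0 (bounded pm)) pm , bounded
greatest P? (suc N) bounded pm with P? (suc N)
... | yes pN = suc N , pN , bounded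
... | no ¬pN = greatest P? N (λ pm′ → s≤s⁻¹ (≤∧≢⇒< (bounded pm′) λ { refl → ¬pN pm′ })) pm

-- Without function extensionality the predicate has to respect pointwise equality.
anyFunction? : ∀ {m k} {P : (Fin m → Fin k) → Set} → (∀ {f g} → f ≗ g → P f → P g) →
  (∀ f → Dec (P f)) → Dec (∃ P)
anyFunction? {zero} resp P? = map′ (_ ,_) (λ (f , pf) → resp (λ ()) pf) (P? λ ())
anyFunction? {suc m} resp P? =
  map′ (λ (a , f , pf) → a ◂ f , pf) (λ (f , pf) → head f , tail f , resp head◂tail pf)
       (any? λ a → anyFunction? (λ f≗g → resp (◂-cong a f≗g)) (λ f → P? (a ◂ f)))
  where
  head◂tail : ∀ {k} {f : Fin (suc m) → Fin k} → f ≗ head f ◂ tail f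
  head◂tail zero    = refl
  head◂tail (suc i) = refl
  ◂-cong : ∀ {k} (a : Fin k) {f g : Fin m → Fin k} → f ≗ g → a ◂ f ≗ a ◂ g
  ◂-cong a f≗g zero    = refl
  ◂-cong a f≗g (suc i) = f≗g i

lookup-injective : ∀ {A : Set} {xs : List A} → Unique xs → Injective _≡_ _≡_ (lookup xs)
lookup-injective {xs = x ∷ xs} (x∉ ∷ u) {zero}  {zero}  e = refl
lookup-injective {xs = x ∷ xs} (x∉ ∷ u) {zero}  {suc j} e = ⊥-elim (All.lookup x∉ (∈-lookup j) e)
lookup-injective {xs = x ∷ xs} (x∉ ∷ u) {suc i} {zero}  e =
  ⊥-elim (All.lookup x∉ (∈-lookup i) (sym e))
lookup-injective {xs = x ∷ xs} (x∉ ∷ u) {suc i} {suc j} e = cong suc (lookup-injective u e)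

module Enumeration {m} {P : Pred (Fin m) 0ℓ} (P? : Decidable P) where

  members : List (Fin m)
  members = filter P? (allFin m)

  size : ℕ
  size = length members

  element : Fin size → Fin m
  element = lookup members

  element-injective : Injective _≡_ _≡_ element
  element-injective = lookup-injective (filter⁺ P? (allFin⁺ m))

  element-satisfies : ∀ i → P (element i)
  element-satisfies i = proj₂ (∈-filter⁻ P? {xs = allFin m} (∈-lookup i))

  position : ∀ {v} → P v → Fin size
  position {v} pv = Any.index (∈-filter⁺ P? (∈-allFin v) pv)

  element-position : ∀ {v} (pv : P v) → element (position pv) ≡ v
  element-position {v} pv = sym (lookup-index (∈-filter⁺ P? (∈-allFin v) pv))

  size≤ : ∀ {t} (h : ∀ {v} → P v → Fin t) →
    (∀ {u v} (pu : P u) (pv : P v) → h pu ≡ h pv → u ≡ v) → size ≤ t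
  size≤ h h-injective =
    injective⇒≤ (element-injective ∘ h-injective (element-satisfies _) (element-satisfies _))

induced : (G : Graph) {m : ℕ} → (Fin m → Fin (n G)) → Graph
induced G {m} f = record
  { n = m ; adj = λ u v → adj G (f u) (f v)
  ; adj-sym = λ u v → adj-sym G (f u) (f v) ; adj-irr = λ v → adj-irr G (f v) }

induced-trans : ∀ {A B C} → InducedSubgraph A B → InducedSubgraph B C → InducedSubgraph A C
induced-trans (f , f-inj , f-adj) (g , g-inj , g-adj) =
  g ∘ f , f-inj ∘ g-inj , λ u v → trans (f-adj u v) (g-adj (f u) (f v))

adjacent? : (G : Graph) → ∀ u v → Dec (Adjacent G u v)
adjacent? G u v = adj G u v Bool.≟ Bool.true

-- IsBAtom t G unfolds to Σ d (Σ c (IsBAtomWith t G d c)).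
IsBAtomWith : (t : ℕ) (G : Graph) → (Fin (n G) → Fin t) → (Fin t → Fin (n G)) → Set
IsBAtomWith t G d c =
    (∀ i → d (c i) ≡ i)
    × (∀ u v → Adjacent G u v → d u ≢ d v)
    × (∀ i → length (filter (λ v → d v ≟ i) (allFin (n G))) ≤ t)
    × (∀ i j → i ≢ j → ∃[ v ] (Adjacent G (c i) v × d v ≡ j))

-- Without function extensionality, graphs with pointwise equal adjacency are not equal, so the
-- notions of Defs are transported between them by hand.
module AgreeingAdjacency (H G : Graph) {f : Fin (n H) → Fin (n G)}
    (same : ∀ u v → adj H u v ≡ adj G (f u) (f v)) where

  H′ : Graph
  H′ = induced G f

  adjacent⇒ : ∀ {u v} → Adjacent H u v → Adjacent H′ u v
  adjacent⇒ {u} {v} = trans (sym (same u v))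

  adjacent⇐ : ∀ {u v} → Adjacent H′ u v → Adjacent H u v
  adjacent⇐ {u} {v} = trans (same u v)

  proper⇒ : ∀ {k} {c c′ : Fin (n H) → Fin k} → c ≗ c′ →
    (∀ u v → Adjacent H u v → c u ≢ c v) → ∀ u v → Adjacent H′ u v → c′ u ≢ c′ v
  proper⇒ c≗c′ proper u v uv e =
    proper u v (adjacent⇐ uv) (trans (c≗c′ u) (trans e (sym (c≗c′ v))))

  properColoring⇒ : ∀ {k c c′} → c ≗ c′ → IsProperColoring H k c → IsProperColoring H′ k c′
  properColoring⇒ c≗c′ (proper , onto) =
    proper⇒ c≗c′ proper , λ j → let (v , cv≡j) = onto j in v , trans (sym (c≗c′ v)) cv≡j

  bVertex⇒ : ∀ {k c c′ v} → c ≗ c′ → IsBVertex H k c v → IsBVertex H′ k c′ v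
  bVertex⇒ {v = v} c≗c′ isB j j≢ =
    let (w , vw , cw≡j) = isB j (λ e → j≢ (trans e (c≗c′ v)))
    in w , adjacent⇒ vw , trans (sym (c≗c′ w)) cw≡j

  bColoring⇒ : ∀ {k c c′} → c ≗ c′ → IsBColoring H k c → IsBColoring H′ k c′
  bColoring⇒ c≗c′ (isProper , bVertices) =
    properColoring⇒ c≗c′ isProper ,
    λ i → let (v , cv≡i , isB) = bVertices i in v , trans (sym (c≗c′ v)) cv≡i , bVertex⇒ c≗c′ isB

  bAtomWith⇒ : ∀ {t d d′ c c′} → d ≗ d′ → c ≗ c′ → IsBAtomWith t H d c → IsBAtomWith t H′ d′ c′
  bAtomWith⇒ {t} {d} {d′} {c} {c′} d≗d′ c≗c′ (centred , proper , small , dominating) =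
    (λ i → trans (sym (d≗d′ (c′ i))) (trans (cong d (sym (c≗c′ i))) (centred i))) ,
    proper⇒ d≗d′ proper ,
    (λ i → subst (_≤ t) (cong length (filter-≐ _ _ (same-class i) (allFin (n H)))) (small i)) ,
    λ i j i≢j → let (v , civ , dv≡j) = dominating i j i≢j
                in v , adjacent⇒ (subst (λ x → Adjacent H x v) (c≗c′ i) civ) ,
                   trans (sym (d≗d′ v)) dv≡j
    where
    same-class : ∀ i → (∀ {v} → d v ≡ i → d′ v ≡ i) × (∀ {v} → d′ v ≡ i → d v ≡ i)
    same-class i = (λ {v} → trans (sym (d≗d′ v))) , (λ {v} → trans (d≗d′ v))

  hasProperColoring⇒ : ∀ {k} → HasProperColoring H k → HasProperColoring H′ k
  hasProperColoring⇒ (c , isProper) = c , properColoring⇒ (λ _ → refl) isProper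

  hasBColoring⇒ : ∀ {k} → HasBColoring H k → HasBColoring H′ k
  hasBColoring⇒ (c , isB) = c , bColoring⇒ (λ _ → refl) isB

unboundedBAtom-transfer : ∀ {k} H G {f : Fin (n H) → Fin (n G)} →
  (∀ u v → adj H u v ≡ adj G (f u) (f v)) → IsUnboundedBAtom k H → IsUnboundedBAtom k (induced G f)
unboundedBAtom-transfer H G {f} same
  ((a , b , (hasP , χ-least) , (hasB , φ-greatest) , a+k<b) , t , d , c , atom) =
  (a , b , (⇒.hasProperColoring⇒ hasP , λ b′ → χ-least b′ ∘ ⇐.hasProperColoring⇒) ,
           (⇒.hasBColoring⇒ hasB , λ b′ → φ-greatest b′ ∘ ⇐.hasBColoring⇒) , a+k<b) ,
  t , d , c , ⇒.bAtomWith⇒ (λ _ → refl) (λ _ → refl) atom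
  where
  module ⇒ = AgreeingAdjacency H G same
  module ⇐ = AgreeingAdjacency (induced G f) H {λ v → v} (λ u v → sym (same u v))

module _ (G : Graph) where

  onto⇒≤ : ∀ {k} (c : Fin (n G) → Fin k) → (∀ j → ∃[ v ] c v ≡ j) → k ≤ n G
  onto⇒≤ c onto = injective⇒≤ {f = proj₁ ∘ onto}
    λ {i} {j} e → trans (sym (proj₂ (onto i))) (trans (cong c e) (proj₂ (onto j)))

  hasProperColoring⇒≤ : ∀ {k} → HasProperColoring G k → k ≤ n G
  hasProperColoring⇒≤ (c , _ , onto) = onto⇒≤ c onto

  hasBColoring⇒≤ : ∀ {k} → HasBColoring G k → k ≤ n G
  hasBColoring⇒≤ (c , (_ , onto) , _) = onto⇒≤ c onto

  bAtom⇒≤ : ∀ {t} → IsBAtom t G → t ≤ n G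
  bAtom⇒≤ (d , c , centred , _) =
    injective⇒≤ {f = c} λ {i} {j} e → trans (sym (centred i)) (trans (cong d e) (centred j))

  proper⇒hasProperColoring≤ : ∀ a (c : Fin (n G) → Fin a) → (∀ u v → Adjacent G u v → c u ≢ c v) →
    ∃ λ a′ → a′ ≤ a × HasProperColoring G a′
  proper⇒hasProperColoring≤ a c proper with all? (λ j → any? (λ v → c v ≟ j))
  ... | yes onto = a , ≤-refl , c , proper , onto
  proper⇒hasProperColoring≤ zero c proper | no ¬onto = ⊥-elim (¬onto (λ ()))
  proper⇒hasProperColoring≤ (suc a) c proper | no ¬onto
    with j , unused ← ¬∀⟶∃¬ _ _ (λ j → any? (λ v → c v ≟ j)) ¬onto
    with a′ , a′≤a , coloring ← proper⇒hasProperColoring≤ a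
           (λ v → punchOut {i = j} {j = c v} λ e → unused (v , sym e))
           (λ u v uv e → proper u v uv
              (punchOut-injective (λ e → unused (u , sym e)) (λ e → unused (v , sym e)) e))
    = a′ , m≤n⇒m≤1+n a′≤a , coloring

module Decide (G : Graph) where
  private
    module Self = AgreeingAdjacency G G {λ v → v} (λ _ _ → refl)

  isProperColoring? : ∀ k c → Dec (IsProperColoring G k c)
  isProperColoring? k c =
    (all? λ u → all? λ v → adjacent? G u v →-dec ¬? (c u ≟ c v)) ×-dec (all? λ j → any? λ v → c v ≟ j)

  isBColoring? : ∀ k c → Dec (IsBColoring G k c)
  isBColoring? k c = isProperColoring? k c ×-dec (all? λ i → any? λ v → (c v ≟ i) ×-dec isBVertex? v)
    where
    isBVertex? : ∀ v → Dec (IsBVertex G k c v)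
    isBVertex? v = all? λ j → ¬? (j ≟ c v) →-dec (any? λ w → adjacent? G v w ×-dec (c w ≟ j))

  hasProperColoring? : ∀ k → Dec (HasProperColoring G k)
  hasProperColoring? k = anyFunction? Self.properColoring⇒ (isProperColoring? k)

  hasBColoring? : ∀ k → Dec (HasBColoring G k)
  hasBColoring? k = anyFunction? Self.bColoring⇒ (isBColoring? k)

  isChromaticNumber? : ∀ a → Dec (IsChromaticNumber G a)
  isChromaticNumber? a =
    map′ (λ (hasP , none) → hasP , λ b hasP′ → ≮⇒≥ λ b<a → none b<a hasP′)
         (λ (hasP , minimal) → hasP , λ {b} b<a hasP′ → <⇒≱ b<a (minimal b hasP′))
         none-below
    where
    none-below : Dec (HasProperColoring G a × (∀ {b} → b < a → ¬ HasProperColoring G b))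
    none-below = hasProperColoring? a ×-dec allUpTo? (λ b → ¬? (hasProperColoring? b)) a

  isBChromaticNumber? : ∀ b → Dec (IsBChromaticNumber G b)
  isBChromaticNumber? b =
    map′ (λ (hasB , below) → hasB , λ b′ hasB′ → below (s≤s (hasBColoring⇒≤ G hasB′)) hasB′)
         (λ (hasB , maximal) → hasB , λ {b′} _ → maximal b′)
         none-above
    where
    none-above : Dec (HasBColoring G b × (∀ {b′} → b′ < suc (n G) → HasBColoring G b′ → b′ ≤ b))
    none-above = hasBColoring? b ×-dec allUpTo? (λ b′ → hasBColoring? b′ →-dec (b′ ≤? b)) (suc (n G))

  bGapExceeds? : ∀ k → Dec (BGapExceeds k G)
  bGapExceeds? k =
    map′ (λ (a , _ , b , _ , gap) → a , b , gap)
         (λ (a , b , gap@((hasP , _) , (hasB , _) , _)) →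
            a , s≤s (hasProperColoring⇒≤ G hasP) , b , s≤s (hasBColoring⇒≤ G hasB) , gap)
         (anyUpTo? (λ a → anyUpTo? (λ b →
            isChromaticNumber? a ×-dec isBChromaticNumber? b ×-dec (a + k <? b))
            (suc (n G))) (suc (n G)))

  isBAtomWith? : ∀ t d c → Dec (IsBAtomWith t G d c)
  isBAtomWith? t d c = (all? λ i → d (c i) ≟ i)
    ×-dec (all? λ u → all? λ v → adjacent? G u v →-dec ¬? (d u ≟ d v))
    ×-dec (all? λ i → length (filter (λ v → d v ≟ i) (allFin (n G))) ≤? t)
    ×-dec (all? λ i → all? λ j → ¬? (i ≟ j) →-dec any? λ v → adjacent? G (c i) v ×-dec (d v ≟ j))

  isBAtom? : ∀ t → Dec (IsBAtom t G)
  isBAtom? t = anyFunction? (λ d≗d′ (c , atom) → c , Self.bAtomWith⇒ d≗d′ (λ _ → refl) atom)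
    λ d → anyFunction? (Self.bAtomWith⇒ (λ _ → refl)) (isBAtomWith? t d)

  isUnboundedBAtom? : ∀ k → Dec (IsUnboundedBAtom k G)
  isUnboundedBAtom? k = bGapExceeds? k ×-dec
    map′ (λ (t , _ , atom) → t , atom) (λ (t , atom) → t , s≤s (bAtom⇒≤ G atom) , atom)
         (anyUpTo? isBAtom? (suc (n G)))

module _ (G : Graph) where
  private
    module D = Decide G

  chromaticNumber-exists : ∀ {a} → HasProperColoring G a → ∃ λ χ → χ ≤ a × IsChromaticNumber G χ
  chromaticNumber-exists hasP =
    let (χ , hasPχ , none) = least D.hasProperColoring? hasP
    in χ , ≮⇒≥ (λ a<χ → none a<χ hasP) , hasPχ , λ b hasPb → ≮⇒≥ λ b<χ → none b<χ hasPb

  bChromaticNumber-exists : ∀ {b} → HasBColoring G b → ∃ λ φ → b ≤ φ × IsBChromaticNumber G φ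
  bChromaticNumber-exists hasB =
    let (φ , hasBφ , below) = greatest D.hasBColoring? (n G) (hasBColoring⇒≤ G) hasB
    in φ , below hasB , hasBφ , λ _ → below

chromaticNumber-mono : ∀ {H G a} → InducedSubgraph H G → IsChromaticNumber G a →
  ∃ λ a′ → a′ ≤ a × IsChromaticNumber H a′
chromaticNumber-mono {H} {G} (f , _ , f-adj) ((c , proper , _) , _) =
  let (a″ , a″≤a , hasP) = proper⇒hasProperColoring≤ H _ (c ∘ f)
                              λ u v uv → proper (f u) (f v) (trans (sym (f-adj u v)) uv)
      (a′ , a′≤a″ , χ) = chromaticNumber-exists H hasP
  in a′ , ≤-trans a′≤a″ a″≤a , χ

module BAtomInside (H : Graph) {b : ℕ} {col : Fin (n H) → Fin b} (isB : IsBColoring H b col) where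
  private
    proper : ∀ u v → Adjacent H u v → col u ≢ col v
    proper = proj₁ (proj₁ isB)

    centre : Fin b → Fin (n H)
    centre i = proj₁ (proj₂ isB i)

    col-centre : ∀ i → col (centre i) ≡ i
    col-centre i = proj₁ (proj₂ (proj₂ isB i))

    centre-isB : ∀ i → IsBVertex H b col (centre i)
    centre-isB i = proj₂ (proj₂ (proj₂ isB i))

    witness : (i l : Fin b) → Σ (Fin (n H)) λ w →
      col w ≡ l × (i ≡ l → w ≡ centre i) × (i ≢ l → Adjacent H (centre i) w)
    witness i l with i ≟ l
    ... | yes refl = centre i , col-centre i , (λ _ → refl) , λ i≢i → ⊥-elim (i≢i refl)
    ... | no i≢l =
      let (w , adjacent , col-w) = centre-isB i l λ e → i≢l (sym (trans e (col-centre i)))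
      in w , col-w , (λ i≡l → ⊥-elim (i≢l i≡l)) , λ _ → adjacent

    pick : Fin b → Fin b → Fin (n H)
    pick i l = proj₁ (witness i l)

    col-pick : ∀ i l → col (pick i l) ≡ l
    col-pick i l = proj₁ (proj₂ (witness i l))

    pick-diagonal : ∀ i → pick i i ≡ centre i
    pick-diagonal i = proj₁ (proj₂ (proj₂ (witness i i))) refl

    pick-adjacent : ∀ {i l} → i ≢ l → Adjacent H (centre i) (pick i l)
    pick-adjacent {i} {l} = proj₂ (proj₂ (proj₂ (witness i l)))

    Picked : Pred (Fin (n H)) 0ℓ
    Picked v = ∃₂ λ i l → pick i l ≡ v

  open Enumeration {P = Picked} (λ v → any? λ i → any? λ l → pick i l ≟ v)

  atom : Graph
  atom = induced H element

  atom-induced : InducedSubgraph atom H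
  atom-induced = element , element-injective , λ _ _ → refl

  colour : Fin size → Fin b
  colour = col ∘ element

  special : Fin b → Fin size
  special i = position (i , i , pick-diagonal i)

  neighbour : Fin b → Fin b → Fin size
  neighbour i l = position (i , l , refl)

  colour-special : ∀ i → colour (special i) ≡ i
  colour-special i = trans (cong col (element-position _)) (col-centre i)

  colour-neighbour : ∀ i l → colour (neighbour i l) ≡ l
  colour-neighbour i l = trans (cong col (element-position _)) (col-pick i l)

  adjacent-neighbour : ∀ i l → i ≢ l → Adjacent atom (special i) (neighbour i l)
  adjacent-neighbour i l i≢l =
    subst₂ (Adjacent H) (sym (element-position _)) (sym (element-position _)) (pick-adjacent i≢l)

  colour-proper : ∀ u v → Adjacent atom u v → colour u ≢ colour v
  colour-proper u v = proper (element u) (element v)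

  -- A vertex of colour l in the atom can only have been picked as pick i l, so i determines it.
  colourClass≤ : ∀ l → length (filter (λ v → colour v ≟ l) (allFin size)) ≤ b
  colourClass≤ l = Enumeration.size≤ (λ v → colour v ≟ l) (λ {v} _ → chooser v) chooser-injective
    where
    chooser : Fin size → Fin b
    chooser v = proj₁ (element-satisfies v)

    element≡pick : ∀ v → colour v ≡ l → element v ≡ pick (chooser v) l
    element≡pick v colour-v =
      let (i , l′ , pick≡) = element-satisfies v
      in trans (sym pick≡)
               (cong (pick i) (trans (sym (col-pick i l′)) (trans (cong col pick≡) colour-v)))

    chooser-injective : ∀ {u v} (cu : colour u ≡ l) (cv : colour v ≡ l) → chooser u ≡ chooser v → u ≡ v
    chooser-injective {u} {v} cu cv e =
      element-injective
        (trans (element≡pick u cu) (trans (cong (λ i → pick i l) e) (sym (element≡pick v cv))))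

  atom-isBAtom : IsBAtom b atom
  atom-isBAtom = colour , special , colour-special , colour-proper , colourClass≤ ,
    λ i l i≢l → neighbour i l , adjacent-neighbour i l i≢l , colour-neighbour i l

  atom-hasBColoring : HasBColoring atom b
  atom-hasBColoring = colour , (colour-proper , λ i → special i , colour-special i) ,
    λ i → special i , colour-special i , λ l l≢ →
      neighbour i l ,
      adjacent-neighbour i l (λ e → l≢ (trans (sym e) (sym (colour-special i)))) ,
      colour-neighbour i l

bGapExceeds⇒unboundedBAtom : ∀ {k} (H : Graph) → BGapExceeds k H →
  Σ Graph λ A → InducedSubgraph A H × IsUnboundedBAtom k A
bGapExceeds⇒unboundedBAtom {k} H (a , b , χH , ((_ , isB) , _) , a+k<b) =
  let (a′ , a′≤a , χA) = chromaticNumber-mono {atom} {H} atom-induced χH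
      (φ , b≤φ , φA) = bChromaticNumber-exists atom atom-hasBColoring
  in atom , atom-induced ,
     (a′ , φ , χA , φA , ≤-<-trans (+-monoˡ-≤ k a′≤a) (<-≤-trans a+k<b b≤φ)) , b , atom-isBAtom
  where open BAtomInside H isB

module _ (k : ℕ) (G : Graph) where

  UnboundedBAtomOfOrder : ℕ → Set
  UnboundedBAtomOfOrder m =
    Σ (Fin m → Fin (n G)) λ f → Injective _≡_ _≡_ f × IsUnboundedBAtom k (induced G f)

  unboundedBAtomOfOrder? : ∀ m → Dec (UnboundedBAtomOfOrder m)
  unboundedBAtomOfOrder? m =
    anyFunction? resp λ f → injective? f ×-dec Decide.isUnboundedBAtom? (induced G f) k
    where
    injective? : (f : Fin m → Fin (n G)) → Dec (Injective _≡_ _≡_ f)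
    injective? f = map′ (λ inj {x} {y} → inj x y) (λ inj x y → inj {x} {y})
                        (all? λ x → all? λ y → (f x ≟ f y) →-dec (x ≟ y))

    resp : ∀ {f g} → f ≗ g → Injective _≡_ _≡_ f × IsUnboundedBAtom k (induced G f) →
           Injective _≡_ _≡_ g × IsUnboundedBAtom k (induced G g)
    resp {f} {g} f≗g (f-inj , unbounded) =
      (λ {x} {y} e → f-inj (trans (f≗g x) (trans e (sym (f≗g y))))) ,
      unboundedBAtom-transfer (induced G f) G (λ u v → cong₂ (adj G) (f≗g u) (f≗g v)) unbounded

  induced⇒unboundedBAtomOfOrder : ∀ H → InducedSubgraph H G → IsUnboundedBAtom k H →
    UnboundedBAtomOfOrder (n H)
  induced⇒unboundedBAtomOfOrder H (f , f-inj , f-adj) unbounded =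
    f , f-inj , unboundedBAtom-transfer H G f-adj unbounded

  noUnboundedBAtom⇒bounded : (∀ {m} → m ≤ n G → ¬ UnboundedBAtomOfOrder m) → BChiBounded k G
  noUnboundedBAtom⇒bounded none H H⊆G a b χ φ with b ≤? a + k
  ... | yes b≤a+k = b≤a+k
  ... | no b≰a+k =
    let (A , A⊆H , unbounded) = bGapExceeds⇒unboundedBAtom H (a , b , χ , φ , ≰⇒> b≰a+k)
        A⊆G = induced-trans {A} {H} {G} A⊆H H⊆G
    in ⊥-elim (none (injective⇒≤ (proj₁ (proj₂ A⊆G))) (induced⇒unboundedBAtomOfOrder A A⊆G unbounded))

  unbounded⇒unboundedBAtomOfOrder : ¬ BChiBounded k G → ∃ UnboundedBAtomOfOrder
  unbounded⇒unboundedBAtomOfOrder ¬bounded with anyUpTo? unboundedBAtomOfOrder? (suc (n G))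
  ... | yes (m , _ , atom) = m , atom
  ... | no none = ⊥-elim (¬bounded (noUnboundedBAtom⇒bounded λ m≤n atom → none (_ , s≤s m≤n , atom)))

  unboundedBAtomOfOrder⇒minimal : ∀ {m} → UnboundedBAtomOfOrder m →
    Σ Graph λ H → InducedSubgraph H G × IsMinimalUnboundedBAtom k H
  unboundedBAtomOfOrder⇒minimal atom with least unboundedBAtomOfOrder? atom
  ... | _ , (f , f-inj , unbounded) , smaller =
    induced G f , H⊆G , unbounded ,
    λ H′ (H′⊆H , H′<H) unbounded′ →
      smaller H′<H
        (induced⇒unboundedBAtomOfOrder H′ (induced-trans {H′} {induced G f} {G} H′⊆H H⊆G) unbounded′)
    where
    H⊆G : InducedSubgraph (induced G f) G
    H⊆G = f , f-inj , λ _ _ → refl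

-- The argument does not use 1 ≤ k.
mainTheorem9 : (k : ℕ) → 1 ≤ k → (G : Graph) →
    (¬ BChiBounded k G) ⇔ Σ Graph (λ H → InducedSubgraph H G × IsMinimalUnboundedBAtom k H)
mainTheorem9 k _ G = mk⇔ minimalAtom noBound
  where
  minimalAtom : ¬ BChiBounded k G → Σ Graph λ H → InducedSubgraph H G × IsMinimalUnboundedBAtom k H
  minimalAtom = unboundedBAtomOfOrder⇒minimal k G ∘ proj₂ ∘ unbounded⇒unboundedBAtomOfOrder k G

  noBound : Σ Graph (λ H → InducedSubgraph H G × IsMinimalUnboundedBAtom k H) → ¬ BChiBounded k G
  noBound (H , H⊆G , ((a , b , χ , φ , a+k<b) , _) , _) bounded = <⇒≱ a+k<b (bounded H H⊆G a b χ φ)
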